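{- Let $(E,\mathcal{C},r_{\mathcal{C}})$ be a semimatroid and $\bm x=\{x_e\}_{e\in E}$, $\bm y=\{y_e\}_{e\in E}$ indeterminates. Then \[ Z(\mathcal{C};\xi,\bm x\bm y)=\sum_{T\in\mathcal{C}}\xi^{ -r_\mathcal{C}(T)}\bm y^T(\bm x+1)^TZ(\mathcal{C}/T;\xi,-\bm y). \]
   Context: A semimatroid is a triple $(E,\mathcal{C},r_{\mathcal{C}})$ where $E$ is a finite set, $\mathcal{C}$ is a nonempty simplicial complex on $E$, and $r_{\mathcal{C}}:\mathcal{C}\to\mathbb{N}$ satisfies: (SR1) $0\le r_{\mathcal{C}}(X)\le |X|$; (SR2) $X\subseteq Y$ in $\mathcal{C}$ implies $r_{\mathcal{C}}(X)\le r_{\mathcal{C}}(Y)$; (SR3) if $X,Y,X\cup Y\in\mathcal{C}$ then $r_{\mathcal{C}}(X\cap Y)+r_{\mathcal{C}}(X\cup Y)\le r_{\mathcal{C}}(X)+r_{\mathcal{C}}(Y)$; (SR4) if $X,Y\in\mathcal{C}$ and $r_{\mathcal{C}}(X)=r_{\mathcal{C}}(X\cap Y)$ then $X\cup Y\in\mathcal{C}$; (SR5) if $X,Y\in\mathcal{C}$ and $r_{\mathcal{C}}(X)<r_{\mathcal{C}}(Y)$ then $X\cup\{e\}\in\mathcal{C}$ for some $e\in Y-X$. For $T\in\mathcal{C}$, $\mathcal{C}/T$ is the semimatroid on $E-T$ with central sets $\{Y\subseteq E-T: Y\cup T\in\mathcal{C}\}$ and rank $r_{\mathcal{C}}(Y\cup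 T)-r_{\mathcal{C}}(T)$. For a semimatroid $\mathcal{D}$ on ground set $S$ and variables $\bm z$ indexed by a superset of $S$, $Z(\mathcal{D};\lambda,\bm z)=\sum_{A\in\mathcal{D}}\lambda^{ -r_{\mathcal{D}}(A)}\prod_{e\in A}z_e$. Notation: $\bm y^T=\prod_{e\in T}y_e$, $(\bm x+1)^T=\prod_{e\in T}(x_e+1)$, $(\bm x\bm y)^A=\prod_{e\in A}x_ey_e$, $-\bm y=\{ -y_e\}$. -}

module Defs where

open import Level using (Level; _⊔_)
open import Data.Nat using (ℕ; zero; suc; _≤_; _<_; _∸_)
open import Data.Nat as ℕ using ()
open import Data.Bool using (Bool; true; false; if_then_else_; T)
open import Data.Fin using (Fin)
open import Data.Fin.Subset using (Subset; _∈_; _∉_; _⊆_; _∪_; _∩_; ∣_∣; ⁅_⁆)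
open import Data.Vec using (Vec; []; _∷_; lookup)
open import Data.List using (List; []; _∷_; _++_; map; foldr; allFin)
open import Data.Product using (Σ; ∃; _×_)
open import Relation.Binary.PropositionalEquality using (_≡_)
open import Algebra.Bundles using (CommutativeRing)

allSubsets : (n : ℕ) → List (Subset n)
allSubsets zero = [] ∷ []
allSubsets (suc n) = map (false ∷_) (allSubsets n) ++ map (true ∷_) (allSubsets n)

-- The rank function is a total
-- function on subsets, but only its values on central sets (members of 𝒞)
-- matter: all axioms only constrain those values.
record Semimatroid (n : ℕ) : Set where
  field
    inC : Subset n → Bool
    rank : Subset n → ℕ
  _∈𝒞 : Subset n → Set
  X ∈𝒞 = T (inC X)
  field
    nonempty : ∃ λ X → X ∈𝒞
    downClosed : ∀ {X Y} → X ⊆ Y → Y ∈𝒞 → X ∈𝒞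
    SR1 : ∀ {X} → X ∈𝒞 → rank X ≤ ∣ X ∣
    SR2 : ∀ {X Y} → X ∈𝒞 → Y ∈𝒞 → X ⊆ Y → rank X ≤ rank Y
    SR3 : ∀ {X Y} → X ∈𝒞 → Y ∈𝒞 → (X ∪ Y) ∈𝒞 →
          rank (X ∩ Y) ℕ.+ rank (X ∪ Y) ≤ rank X ℕ.+ rank Y
    SR4 : ∀ {X Y} → X ∈𝒞 → Y ∈𝒞 → rank X ≡ rank (X ∩ Y) → (X ∪ Y) ∈𝒞
    SR5 : ∀ {X Y} → X ∈𝒞 → Y ∈𝒞 → rank X < rank Y →
          Σ (Fin n) λ e → e ∈ Y × e ∉ X × (X ∪ ⁅ e ⁆) ∈𝒞

module Gen {c ℓ : Level} (R : CommutativeRing c ℓ) where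
  open CommutativeRing R

  infixr 8 _^_
  _^_ : Carrier → ℕ → Carrier
  a ^ zero = 1#
  a ^ suc k = a * (a ^ k)

  sumL : {A : Set} → (A → Carrier) → List A → Carrier
  sumL f = foldr (λ a s → f a + s) 0#

  prodS : {n : ℕ} → (Fin n → Carrier) → Subset n → Carrier
  prodS {n} z A = foldr (λ e p → (if lookup A e then z e else 1#) * p) 1# (allFin n)

  sumWhere : {n : ℕ} → (Subset n → Bool) → (Subset n → Carrier) → Carrier
  sumWhere {n} P f = sumL (λ X → if P X then f X else 0#) (allSubsets n)

  disjoint? : {n : ℕ} → Subset n → Subset n → Bool
  disjoint? [] [] = true
  disjoint? (true ∷ X) (true ∷ Y) = false
  disjoint? (_ ∷ X) (_ ∷ Y) = disjoint? X Y

  andB : Bool → Bool → Bool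
  andB true b = b
  andB false _ = false

  module _ {n : ℕ} (M : Semimatroid n) where
    open Semimatroid M

    -- Z(𝒞; λ, z) = Σ_{A ∈ 𝒞} λ^{-r(A)} z^A, with λinv standing for λ^{-1}.
    Z : (λinv : Carrier) → (Fin n → Carrier) → Carrier
    Z λinv z = sumWhere inC (λ A → λinv ^ rank A * prodS z A)

    -- Z(𝒞/T; λ, z): the contraction 𝒞/T lives on E - T, with central sets
    -- {Y ⊆ E - T : Y ∪ T ∈ 𝒞} and rank r(Y ∪ T) - r(T).
    Zcontr : (T' : Subset n) → (λinv : Carrier) → (Fin n → Carrier) → Carrier
    Zcontr T' λinv z =
      sumWhere (λ Y → andB (disjoint? Y T') (inC (Y ∪ T')))
               (λ Y → λinv ^ (rank (Y ∪ T') ∸ rank T') * prodS z Y)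

-- Expanding Z(𝒞/T; ξ, -y) and putting A = Y ∪ T, the right-hand side becomes
-- Σ_{A ∈ 𝒞} ξ^{-r(A)} Σ_{T ⊆ A} (y(x+1))^T (-y)^{A-T}: the weights combine because
-- r(T) ≤ r(Y ∪ T) (SR2), and T ∈ 𝒞 is automatic since 𝒞 is closed under subsets.
-- The inner sum is ∏_{e ∈ A} (y_e(x_e+1) - y_e) = (xy)^A by the subset binomial theorem.
module Submission where

open import Defs
open import Level using (Level)
open import Data.Nat as ℕ using (ℕ; zero; suc; _∸_)
open import Data.Nat.Properties using (m+[n∸m]≡n)
open import Data.Bool using (Bool; true; false; if_then_else_)
open import Data.Bool.Properties using (T-≡)
open import Data.Fin using (Fin; zero; suc)
open import Data.Fin.Subset using (Subset; inside; outside; _⊆_; _─_; _∪_)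
open import Data.Fin.Subset.Properties using (_⊆?_; drop-∷-⊆; q⊆p∪q)
open import Data.List using (List; []; _∷_; _++_; foldr; map; allFin)
open import Data.List.Properties using (foldr-map; map-tabulate)
open import Data.Vec using ([]; _∷_; here; lookup)
open import Function using (id)
open import Function.Bundles using (Equivalence)
open import Relation.Nullary using (does; yes; no)
open import Relation.Binary.PropositionalEquality as ≡ using (_≡_)
open import Algebra.Bundles using (CommutativeRing)

p─q∪q≡p : ∀ {n} {p q : Subset n} → q ⊆ p → (p ─ q) ∪ q ≡ p
p─q∪q≡p {p = []} {[]} _ = ≡.refl
p─q∪q≡p {p = inside ∷ p} {outside ∷ q} q⊆p = ≡.cong (inside ∷_) (p─q∪q≡p (drop-∷-⊆ q⊆p))
p─q∪q≡p {p = outside ∷ p} {outside ∷ q} q⊆p = ≡.cong (outside ∷_) (p─q∪q≡p (drop-∷-⊆ q⊆p))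
p─q∪q≡p {p = inside ∷ p} {inside ∷ q} q⊆p = ≡.cong (inside ∷_) (p─q∪q≡p (drop-∷-⊆ q⊆p))
p─q∪q≡p {p = outside ∷ p} {inside ∷ q} q⊆p with q⊆p here
... | ()

module _ {c ℓ : Level} (R : CommutativeRing c ℓ) where
  open CommutativeRing R hiding (zero)
  open Gen R
  open import Algebra.Solver.Ring.NaturalCoefficients.Default commutativeSemiring
  open import Relation.Binary.Reasoning.Setoid setoid

  ^-homo-* : ∀ a m k → a ^ (m ℕ.+ k) ≈ a ^ m * a ^ k
  ^-homo-* a zero k = sym (*-identityˡ _)
  ^-homo-* a (suc m) k = trans (*-cong refl (^-homo-* a m k)) (sym (*-assoc _ _ _))

  if-zero : ∀ b → (if b then 0# else 0#) ≈ 0#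
  if-zero true = refl
  if-zero false = refl

  if-scale : ∀ b {u v} k → u ≈ k * v → (if b then u else 0#) ≈ k * (if b then v else 0#)
  if-scale true k u≈kv = u≈kv
  if-scale false k _ = sym (zeroʳ k)

  sumL-cong : {A : Set} {f g : A → Carrier} (xs : List A) → (∀ a → f a ≈ g a) → sumL f xs ≈ sumL g xs
  sumL-cong [] _ = refl
  sumL-cong (a ∷ xs) f≈g = +-cong (f≈g a) (sumL-cong xs f≈g)

  sumL-++ : {A : Set} (f : A → Carrier) (xs ys : List A) → sumL f (xs ++ ys) ≈ sumL f xs + sumL f ys
  sumL-++ f [] ys = sym (+-identityˡ _)
  sumL-++ f (a ∷ xs) ys = trans (+-cong refl (sumL-++ f xs ys)) (sym (+-assoc _ _ _))

  sumL-+ : {A : Set} (f g : A → Carrier) (xs : List A) → sumL (λ a → f a + g a) xs ≈ sumL f xs + sumL g xs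
  sumL-+ f g [] = sym (+-identityˡ _)
  sumL-+ f g (a ∷ xs) = trans (+-cong refl (sumL-+ f g xs))
    (solve 4 (λ p q r s → (p :+ q) :+ (r :+ s) := (p :+ r) :+ (q :+ s)) refl (f a) (g a) (sumL f xs) (sumL g xs))

  *-distribˡ-sumL : {A : Set} (k : Carrier) (f : A → Carrier) (xs : List A) → k * sumL f xs ≈ sumL (λ a → k * f a) xs
  *-distribˡ-sumL k f [] = zeroʳ k
  *-distribˡ-sumL k f (a ∷ xs) = trans (distribˡ k _ _) (+-cong refl (*-distribˡ-sumL k f xs))

  sumL-zero : {A : Set} (f : A → Carrier) (xs : List A) → (∀ a → f a ≈ 0#) → sumL f xs ≈ 0#
  sumL-zero f [] _ = refl
  sumL-zero f (a ∷ xs) f≈0 = trans (+-cong (f≈0 a) (sumL-zero f xs f≈0)) (+-identityˡ 0#)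

  ∑ : ∀ {n} → (Subset n → Carrier) → Carrier
  ∑ {n} f = sumL f (allSubsets n)

  ∑-cong : ∀ {n} {f g : Subset n → Carrier} → (∀ X → f X ≈ g X) → ∑ f ≈ ∑ g
  ∑-cong {n} = sumL-cong (allSubsets n)

  ∑-+ : ∀ {n} (f g : Subset n → Carrier) → ∑ (λ X → f X + g X) ≈ ∑ f + ∑ g
  ∑-+ {n} f g = sumL-+ f g (allSubsets n)

  *-distribˡ-∑ : ∀ {n} k (f : Subset n → Carrier) → k * ∑ f ≈ ∑ (λ X → k * f X)
  *-distribˡ-∑ {n} k f = *-distribˡ-sumL k f (allSubsets n)

  ∑-zero : ∀ {n} {f : Subset n → Carrier} → (∀ X → f X ≈ 0#) → ∑ f ≈ 0#
  ∑-zero {n} {f} = sumL-zero f (allSubsets n)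

  ∑-suc : ∀ {n} (f : Subset (suc n) → Carrier) → ∑ f ≈ ∑ (λ X → f (outside ∷ X)) + ∑ (λ X → f (inside ∷ X))
  ∑-suc {n} f = begin
      sumL f (map (outside ∷_) (allSubsets n) ++ map (inside ∷_) (allSubsets n))
    ≈⟨ sumL-++ f (map (outside ∷_) (allSubsets n)) (map (inside ∷_) (allSubsets n)) ⟩
      sumL f (map (outside ∷_) (allSubsets n)) + sumL f (map (inside ∷_) (allSubsets n))
    ≡⟨ ≡.cong₂ _+_ (foldr-map _ (outside ∷_) 0# (allSubsets n)) (foldr-map _ (inside ∷_) 0# (allSubsets n)) ⟩
      ∑ (λ X → f (outside ∷ X)) + ∑ (λ X → f (inside ∷ X))
    ∎

  ∑∑-suc : ∀ {n} (h : Subset (suc n) → Subset (suc n) → Carrier) →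
    ∑ (λ S → ∑ (λ X → h S X))
    ≈ (∑ (λ S → ∑ (λ X → h (outside ∷ S) (outside ∷ X))) + ∑ (λ S → ∑ (λ X → h (outside ∷ S) (inside ∷ X))))
      + (∑ (λ S → ∑ (λ X → h (inside ∷ S) (outside ∷ X))) + ∑ (λ S → ∑ (λ X → h (inside ∷ S) (inside ∷ X))))
  ∑∑-suc {n} h = trans (∑-suc {n} _) (+-cong (trans (∑-cong (λ S → ∑-suc {n} (h (outside ∷ S)))) (∑-+ {n} _ _))
                                      (trans (∑-cong (λ S → ∑-suc {n} (h (inside ∷ S)))) (∑-+ {n} _ _)))

  -- Both sides sum G Y T over the pairs of disjoint subsets, indexed by (T, Y) resp. (Y ∪ T, T).
  ∑-disjoint≈∑-⊆ : ∀ {n} (G : Subset n → Subset n → Carrier) →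
    ∑ (λ T → ∑ (λ Y → if disjoint? Y T then G Y T else 0#))
    ≈ ∑ (λ A → ∑ (λ T → if does (T ⊆? A) then G (A ─ T) T else 0#))
  ∑-disjoint≈∑-⊆ {zero} G = refl
  ∑-disjoint≈∑-⊆ {suc n} G = begin
      ∑ (λ T → ∑ (λ Y → if disjoint? Y T then G Y T else 0#))
    ≈⟨ ∑∑-suc (λ T Y → if disjoint? Y T then G Y T else 0#) ⟩
      (disjoints G₀₀ + disjoints G₁₀) + (disjoints G₀₁ + none)
    ≈⟨ +-cong (+-cong (∑-disjoint≈∑-⊆ G₀₀) (∑-disjoint≈∑-⊆ G₁₀)) (+-cong (∑-disjoint≈∑-⊆ G₀₁) refl) ⟩
      (splittings G₀₀ + splittings G₁₀) + (splittings G₀₁ + none)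
    ≈⟨ solve 4 (λ a b c z → (a :+ b) :+ (c :+ z) := (a :+ z) :+ (b :+ c)) refl
             (splittings G₀₀) (splittings G₁₀) (splittings G₀₁) none ⟩
      (splittings G₀₀ + none) + (splittings G₁₀ + splittings G₀₁)
    ≈⟨ ∑∑-suc (λ A T → if does (T ⊆? A) then G (A ─ T) T else 0#) ⟨
      ∑ (λ A → ∑ (λ T → if does (T ⊆? A) then G (A ─ T) T else 0#))
    ∎
    where
    G₀₀ G₁₀ G₀₁ : Subset n → Subset n → Carrier
    G₀₀ Y T = G (outside ∷ Y) (outside ∷ T)
    G₁₀ Y T = G (inside ∷ Y) (outside ∷ T)
    G₀₁ Y T = G (outside ∷ Y) (inside ∷ T)
    disjoints splittings : (Subset n → Subset n → Carrier) → Carrier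
    disjoints g = ∑ (λ T → ∑ (λ Y → if disjoint? Y T then g Y T else 0#))
    splittings g = ∑ (λ A → ∑ (λ T → if does (T ⊆? A) then g (A ─ T) T else 0#))
    none : Carrier
    none = ∑ {n} (λ _ → ∑ {n} (λ _ → 0#))

  prodS-∷ : ∀ {n} (z : Fin (suc n) → Carrier) (a : Bool) (A : Subset n) →
    prodS z (a ∷ A) ≡ (if a then z zero else 1#) * prodS (λ e → z (suc e)) A
  prodS-∷ {n} z a A = ≡.cong ((if a then z zero else 1#) *_)
    (≡.trans (≡.cong (foldr (λ e p → (if lookup (a ∷ A) e then z e else 1#) * p) 1#) (≡.sym (map-tabulate id suc)))
             (foldr-map _ suc 1# (allFin n)))

  prodS-cong : ∀ {n} {f g : Fin n → Carrier} → (∀ e → f e ≈ g e) → ∀ A → prodS f A ≈ prodS g A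
  prodS-cong {zero} f≈g [] = refl
  prodS-cong {suc n} {f} {g} f≈g (a ∷ A) = begin
      prodS f (a ∷ A)
    ≡⟨ prodS-∷ f a A ⟩
      (if a then f zero else 1#) * prodS (λ e → f (suc e)) A
    ≈⟨ *-cong (factor a) (prodS-cong (λ e → f≈g (suc e)) A) ⟩
      (if a then g zero else 1#) * prodS (λ e → g (suc e)) A
    ≡⟨ prodS-∷ g a A ⟨
      prodS g (a ∷ A)
    ∎
    where
    factor : ∀ a → (if a then f zero else 1#) ≈ (if a then g zero else 1#)
    factor true = f≈g zero
    factor false = refl

  prodS-* : ∀ {n} (f g : Fin n → Carrier) A → prodS f A * prodS g A ≈ prodS (λ e → f e * g e) A
  prodS-* {zero} f g [] = *-identityʳ 1#
  prodS-* {suc n} f g (a ∷ A) = begin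
      prodS f (a ∷ A) * prodS g (a ∷ A)
    ≡⟨ ≡.cong₂ _*_ (prodS-∷ f a A) (prodS-∷ g a A) ⟩
      ((if a then f zero else 1#) * F) * ((if a then g zero else 1#) * G)
    ≈⟨ solve 4 (λ p q r s → (p :* q) :* (r :* s) := (p :* r) :* (q :* s)) refl _ F _ G ⟩
      ((if a then f zero else 1#) * (if a then g zero else 1#)) * (F * G)
    ≈⟨ *-cong (factor a) (prodS-* (λ e → f (suc e)) (λ e → g (suc e)) A) ⟩
      (if a then f zero * g zero else 1#) * prodS (λ e → f (suc e) * g (suc e)) A
    ≡⟨ prodS-∷ (λ e → f e * g e) a A ⟨
      prodS (λ e → f e * g e) (a ∷ A)
    ∎
    where
    F G : Carrier
    F = prodS (λ e → f (suc e)) A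
    G = prodS (λ e → g (suc e)) A
    factor : ∀ a → (if a then f zero else 1#) * (if a then g zero else 1#) ≈ (if a then f zero * g zero else 1#)
    factor true = refl
    factor false = *-identityʳ 1#

  ∑-⊆-binomial : ∀ {n} (u v : Fin n → Carrier) A →
    ∑ (λ T → if does (T ⊆? A) then prodS u T * prodS v (A ─ T) else 0#) ≈ prodS (λ e → u e + v e) A
  ∑-⊆-binomial {zero} u v [] = trans (+-identityʳ _) (*-identityʳ 1#)
  ∑-⊆-binomial {suc n} u v (outside ∷ A) = begin
      ∑ (λ T → if does (T ⊆? outside ∷ A) then prodS u T * prodS v ((outside ∷ A) ─ T) else 0#)
    ≈⟨ ∑-suc {n} _ ⟩
      ∑ (λ T → if does (T ⊆? A) then prodS u (outside ∷ T) * prodS v (outside ∷ (A ─ T)) else 0#)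
        + ∑ {n} (λ _ → 0#)
    ≈⟨ +-cong (trans (∑-cong (λ T → if-scale (does (T ⊆? A)) 1# (lower T))) (sym (*-distribˡ-∑ {n} 1# _)))
              (∑-zero {n} (λ _ → refl)) ⟩
      1# * ∑ (λ T → if does (T ⊆? A) then prodS u′ T * prodS v′ (A ─ T) else 0#) + 0#
    ≈⟨ trans (+-identityʳ _) (*-cong refl (∑-⊆-binomial u′ v′ A)) ⟩
      1# * prodS (λ e → u′ e + v′ e) A
    ≡⟨ prodS-∷ (λ e → u e + v e) outside A ⟨
      prodS (λ e → u e + v e) (outside ∷ A)
    ∎
    where
    u′ v′ : Fin n → Carrier
    u′ e = u (suc e)
    v′ e = v (suc e)
    lower : ∀ T → prodS u (outside ∷ T) * prodS v (outside ∷ (A ─ T)) ≈ 1# * (prodS u′ T * prodS v′ (A ─ T))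
    lower T rewrite prodS-∷ u outside T | prodS-∷ v outside (A ─ T) =
      solve 2 (λ p q → (con 1 :* p) :* (con 1 :* q) := con 1 :* (p :* q)) refl _ _
  ∑-⊆-binomial {suc n} u v (inside ∷ A) = begin
      ∑ (λ T → if does (T ⊆? inside ∷ A) then prodS u T * prodS v ((inside ∷ A) ─ T) else 0#)
    ≈⟨ ∑-suc {n} _ ⟩
      ∑ (λ T → if does (T ⊆? A) then prodS u (outside ∷ T) * prodS v (inside ∷ (A ─ T)) else 0#)
        + ∑ (λ T → if does (T ⊆? A) then prodS u (inside ∷ T) * prodS v (outside ∷ (A ─ T)) else 0#)
    ≈⟨ +-cong (∑-cong (λ T → if-scale (does (T ⊆? A)) (v zero) (lowerᵥ T)))
              (∑-cong (λ T → if-scale (does (T ⊆? A)) (u zero) (lowerᵤ T))) ⟩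
      ∑ (λ T → v zero * g T) + ∑ (λ T → u zero * g T)
    ≈⟨ +-cong (*-distribˡ-∑ (v zero) g) (*-distribˡ-∑ (u zero) g) ⟨
      v zero * ∑ g + u zero * ∑ g
    ≈⟨ trans (sym (distribʳ _ _ _)) (*-cong (+-comm _ _) (∑-⊆-binomial u′ v′ A)) ⟩
      (u zero + v zero) * prodS (λ e → u′ e + v′ e) A
    ≡⟨ prodS-∷ (λ e → u e + v e) inside A ⟨
      prodS (λ e → u e + v e) (inside ∷ A)
    ∎
    where
    u′ v′ : Fin n → Carrier
    u′ e = u (suc e)
    v′ e = v (suc e)
    g : Subset n → Carrier
    g T = if does (T ⊆? A) then prodS u′ T * prodS v′ (A ─ T) else 0#
    lowerᵥ : ∀ T → prodS u (outside ∷ T) * prodS v (inside ∷ (A ─ T)) ≈ v zero * (prodS u′ T * prodS v′ (A ─ T))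
    lowerᵥ T rewrite prodS-∷ u outside T | prodS-∷ v inside (A ─ T) =
      solve 3 (λ k p q → (con 1 :* p) :* (k :* q) := k :* (p :* q)) refl _ _ _
    lowerᵤ : ∀ T → prodS u (inside ∷ T) * prodS v (outside ∷ (A ─ T)) ≈ u zero * (prodS u′ T * prodS v′ (A ─ T))
    lowerᵤ T rewrite prodS-∷ u inside T | prodS-∷ v outside (A ─ T) =
      solve 3 (λ k p q → (k :* p) :* (con 1 :* q) := k :* (p :* q)) refl _ _ _

  module _ {n} (M : Semimatroid n) (x y : Fin n → Carrier) (ξinv : Carrier) where
    open Semimatroid M

    ∈𝒞⇒inC : ∀ {X} → X ∈𝒞 → inC X ≡ true
    ∈𝒞⇒inC = Equivalence.to T-≡

    inC⇒∈𝒞 : ∀ {X} → inC X ≡ true → X ∈𝒞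
    inC⇒∈𝒞 = Equivalence.from T-≡

    -- The summand of Σ_{A ∈ 𝒞} ξ^{-r(A)} Σ_{T ⊆ A} (y(x+1))^T (-y)^{A-T}, written with Y = A - T.
    term : Subset n → Subset n → Carrier
    term Y T = if inC (Y ∪ T) then ξinv ^ rank (Y ∪ T) * (prodS (λ e → y e * (x e + 1#)) T * prodS (λ e → - y e) Y) else 0#

    contraction-term : ∀ T →
      (if inC T then ξinv ^ rank T * prodS y T * prodS (λ e → x e + 1#) T * Zcontr M T ξinv (λ e → - y e) else 0#)
      ≈ ∑ (λ Y → if disjoint? Y T then term Y T else 0#)
    contraction-term T with inC T in T∈𝒞
    ... | false = sym (∑-zero vanish)
      where
      vanish : ∀ Y → (if disjoint? Y T then term Y T else 0#) ≈ 0#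
      vanish Y with disjoint? Y T
      ... | false = refl
      ... | true with inC (Y ∪ T) in Y∪T∈𝒞
      ...   | false = refl
      ...   | true with ≡.trans (≡.sym (∈𝒞⇒inC (downClosed (q⊆p∪q Y T) (inC⇒∈𝒞 Y∪T∈𝒞)))) T∈𝒞
      ...     | ()
    ... | true = trans (*-distribˡ-∑ {n} _ _) (∑-cong distribute)
      where
      distribute : ∀ Y →
        ξinv ^ rank T * prodS y T * prodS (λ e → x e + 1#) T
          * (if andB (disjoint? Y T) (inC (Y ∪ T))
             then ξinv ^ (rank (Y ∪ T) ∸ rank T) * prodS (λ e → - y e) Y else 0#)
        ≈ (if disjoint? Y T then term Y T else 0#)
      distribute Y with disjoint? Y T
      ... | false = zeroʳ _
      ... | true with inC (Y ∪ T) in Y∪T∈𝒞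
      ...   | false = zeroʳ _
      ...   | true = begin
          ξinv ^ rank T * prodS y T * prodS (λ e → x e + 1#) T * (ξinv ^ (rank (Y ∪ T) ∸ rank T) * prodS (λ e → - y e) Y)
        ≈⟨ solve 5 (λ a b d k e → ((a :* b) :* d) :* (k :* e) := (a :* k) :* ((b :* d) :* e)) refl _ _ _ _ _ ⟩
          ξinv ^ rank T * ξinv ^ (rank (Y ∪ T) ∸ rank T) * (prodS y T * prodS (λ e → x e + 1#) T * prodS (λ e → - y e) Y)
        ≈⟨ *-cong (^-homo-* ξinv (rank T) _) (*-cong (sym (prodS-* y (λ e → x e + 1#) T)) refl) ⟨
          ξinv ^ (rank T ℕ.+ (rank (Y ∪ T) ∸ rank T)) * (prodS (λ e → y e * (x e + 1#)) T * prodS (λ e → - y e) Y)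
        ≡⟨ ≡.cong (λ k → ξinv ^ k * _) (m+[n∸m]≡n (SR2 (inC⇒∈𝒞 T∈𝒞) (inC⇒∈𝒞 Y∪T∈𝒞) (q⊆p∪q Y T))) ⟩
          ξinv ^ rank (Y ∪ T) * (prodS (λ e → y e * (x e + 1#)) T * prodS (λ e → - y e) Y)
        ∎

    ∑-splittings-term : ∀ A →
      ∑ (λ T → if does (T ⊆? A) then term (A ─ T) T else 0#)
      ≈ (if inC A then ξinv ^ rank A * prodS (λ e → x e * y e) A else 0#)
    ∑-splittings-term A = trans (∑-cong rejoin) (collect (inC A))
      where
      rejoin : ∀ T → (if does (T ⊆? A) then term (A ─ T) T else 0#)
        ≈ (if does (T ⊆? A) then (if inC A then ξinv ^ rank A * (prodS (λ e → y e * (x e + 1#)) T * prodS (λ e → - y e) (A ─ T)) else 0#) else 0#)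
      rejoin T with T ⊆? A
      ... | yes T⊆A rewrite p─q∪q≡p T⊆A = refl
      ... | no _ = refl
      y[x+1]-y≈xy : ∀ e → y e * (x e + 1#) + - y e ≈ x e * y e
      y[x+1]-y≈xy e = begin
          y e * (x e + 1#) + - y e        ≈⟨ +-cong (distribˡ (y e) (x e) 1#) refl ⟩
          (y e * x e + y e * 1#) + - y e  ≈⟨ +-assoc _ _ _ ⟩
          y e * x e + (y e * 1# + - y e)  ≈⟨ +-cong (*-comm (y e) (x e)) (trans (+-cong (*-identityʳ (y e)) refl) (-‿inverseʳ (y e))) ⟩
          x e * y e + 0#                  ≈⟨ +-identityʳ _ ⟩
          x e * y e                       ∎
      collect : ∀ b →
        ∑ (λ T → if does (T ⊆? A) then (if b then ξinv ^ rank A * (prodS (λ e → y e * (x e + 1#)) T * prodS (λ e → - y e) (A ─ T)) else 0#) else 0#)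
        ≈ (if b then ξinv ^ rank A * prodS (λ e → x e * y e) A else 0#)
      collect false = ∑-zero (λ T → if-zero (does (T ⊆? A)))
      collect true = begin
          ∑ (λ T → if does (T ⊆? A) then ξinv ^ rank A * (prodS (λ e → y e * (x e + 1#)) T * prodS (λ e → - y e) (A ─ T)) else 0#)
        ≈⟨ ∑-cong (λ T → if-scale (does (T ⊆? A)) _ refl) ⟩
          ∑ (λ T → ξinv ^ rank A * (if does (T ⊆? A) then prodS (λ e → y e * (x e + 1#)) T * prodS (λ e → - y e) (A ─ T) else 0#))
        ≈⟨ *-distribˡ-∑ {n} _ _ ⟨
          ξinv ^ rank A * ∑ (λ T → if does (T ⊆? A) then prodS (λ e → y e * (x e + 1#)) T * prodS (λ e → - y e) (A ─ T) else 0#)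
        ≈⟨ *-cong refl (trans (∑-⊆-binomial _ _ A) (prodS-cong y[x+1]-y≈xy A)) ⟩
          ξinv ^ rank A * prodS (λ e → x e * y e) A
        ∎

    Z-expansion :
      Z M ξinv (λ e → x e * y e)
      ≈ sumWhere inC (λ T → ξinv ^ rank T * prodS y T * prodS (λ e → x e + 1#) T * Zcontr M T ξinv (λ e → - y e))
    Z-expansion = sym (begin
        ∑ (λ T → if inC T then ξinv ^ rank T * prodS y T * prodS (λ e → x e + 1#) T * Zcontr M T ξinv (λ e → - y e) else 0#)
      ≈⟨ ∑-cong contraction-term ⟩
        ∑ (λ T → ∑ (λ Y → if disjoint? Y T then term Y T else 0#))
      ≈⟨ ∑-disjoint≈∑-⊆ term ⟩
        ∑ (λ A → ∑ (λ T → if does (T ⊆? A) then term (A ─ T) T else 0#))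
      ≈⟨ ∑-cong ∑-splittings-term ⟩
        ∑ (λ A → if inC A then ξinv ^ rank A * prodS (λ e → x e * y e) A else 0#)
      ∎)

theorem2p10 : {c ℓ : Level} (R : CommutativeRing c ℓ) {n : ℕ} (M : Semimatroid n)
    (x y : Fin n → CommutativeRing.Carrier R) (ξ ξinv : CommutativeRing.Carrier R) →
    CommutativeRing._≈_ R (CommutativeRing._*_ R ξ ξinv) (CommutativeRing.1# R) →
    let open CommutativeRing R
        open Gen R
    in Z M ξinv (λ e → x e * y e)
       ≈ sumWhere (Semimatroid.inC M)
           (λ T' → ξinv ^ Semimatroid.rank M T' * prodS y T'
                   * prodS (λ e → x e + 1#) T' * Zcontr M T' ξinv (λ e → - y e))
theorem2p10 R M x y _ ξinv _ = Z-expansion R M x y ξinv
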